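{- $\mathbf{PF}^\omega$ is a conservative extension of $\mathbf{S4.2}$: for every $\mathcal L_{\mathsf f}$-formula $A$, $\mathbf{PF}^\omega\vdash A$ iff $\mathbf{S4.2}\vdash A$.
   Context: $\mathcal L_{\mathsf f}$ is the unimodal propositional language with modal operator $\Box_{\mathsf f}$; $\mathcal L_{\mathsf{pf}}$ adds a second operator $\Box_{\mathsf p}$ ($\Diamond=\neg\Box\neg$). $\mathbf{S4.2}$ has axioms: propositional tautologies, $\Box_{\mathsf f}(A\to B)\to(\Box_{\mathsf f}A\to\Box_{\mathsf f}B)$, $\Box_{\mathsf f}A\to A$, $\Box_{\mathsf f}A\to\Box_{\mathsf f}\Box_{\mathsf f}A$, $\Diamond_{\mathsf f}\Box_{\mathsf f}A\to\Box_{\mathsf f}\Diamond_{\mathsf f}A$; rules modus ponens and $\Box_{\mathsf f}$-necessitation. $\mathbf{PF}$ (in $\mathcal L_{\mathsf{pf}}$) has axioms: propositional tautologies; the $\mathbf{S4.2}$ axioms; $\Box_{\mathsf p}(A\to B)\to(\Box_{\mathsf p}A\to\Box_{\mathsf p}B)$; $\Box_{\mathsf p}(\Box_{\mathsf p}A\to A)\to\Box_{\mathsf p}A$; $\Box_{\mathsf p}A\to\Box_{\mathsf f}\Box_{\mathsf p}A$; $\Diamond_{\mathsf p}A\to\Box_{\mathsf f}\Diamond_{\mathsf p}A$; $\Box_{\mathsf p}A\to\Box_{\mathsf p}\Box_{\mathsf f}A$; rules modus ponens and necessitation for $\Box_{\mathsf p}$ and $\Box_{\mathsf f}$. $\mathbf{PF}^\omega$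 has as axioms all theorems of $\mathbf{PF}$ and all $\Box_{\mathsf p}A\to\Box_{\mathsf f}A$, with modus ponens as sole rule. -}

module Defs where

open import Data.Nat using (ℕ)
open import Data.Bool using (Bool; true; false; not; _∨_)
open import Relation.Binary.PropositionalEquality using (_≡_)

infixr 5 _⇒_
data Fm : Set where
  var : ℕ → Fm
  ⊥'  : Fm
  _⇒_ : Fm → Fm → Fm
  □f  : Fm → Fm
  □p  : Fm → Fm

¬' : Fm → Fm
¬' A = A ⇒ ⊥'

◇f : Fm → Fm
◇f A = ¬' (□f (¬' A))

◇p : Fm → Fm
◇p A = ¬' (□p (¬' A))

data IsLf : Fm → Set where
  var : ∀ n → IsLf (var n)
  ⊥'  : IsLf ⊥'
  _⇒_ : ∀ {A B} → IsLf A → IsLf B → IsLf (A ⇒ B)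
  □f  : ∀ {A} → IsLf A → IsLf (□f A)

-- Propositional tautologies: true under every Boolean valuation of the
-- propositional atoms and of the modalized subformulas (treated as atoms).
record Valuation : Set where
  field
    atom : ℕ → Bool
    boxf : Fm → Bool
    boxp : Fm → Bool

eval : Valuation → Fm → Bool
eval v (var n) = Valuation.atom v n
eval v ⊥'      = false
eval v (A ⇒ B) = not (eval v A) ∨ eval v B
eval v (□f A)  = Valuation.boxf v A
eval v (□p A)  = Valuation.boxp v A

Tautology : Fm → Set
Tautology A = ∀ (v : Valuation) → eval v A ≡ true

-- S4.2, a logic in the language L_f: all axiom instances are L_f-formulas.
data S42⊢_ : Fm → Set where
  taut : ∀ {A} → IsLf A → Tautology A → S42⊢ A
  K    : ∀ {A B} → IsLf A → IsLf B → S42⊢ (□f (A ⇒ B) ⇒ (□f A ⇒ □f B))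
  T    : ∀ {A} → IsLf A → S42⊢ (□f A ⇒ A)
  ax4  : ∀ {A} → IsLf A → S42⊢ (□f A ⇒ □f (□f A))
  ax2  : ∀ {A} → IsLf A → S42⊢ (◇f (□f A) ⇒ □f (◇f A))
  mp   : ∀ {A B} → S42⊢ (A ⇒ B) → S42⊢ A → S42⊢ B
  nec  : ∀ {A} → S42⊢ A → S42⊢ (□f A)

data PF⊢_ : Fm → Set where
  taut  : ∀ {A} → Tautology A → PF⊢ A
  Kf    : ∀ {A B} → PF⊢ (□f (A ⇒ B) ⇒ (□f A ⇒ □f B))
  Tf    : ∀ {A} → PF⊢ (□f A ⇒ A)
  4f    : ∀ {A} → PF⊢ (□f A ⇒ □f (□f A))
  2f    : ∀ {A} → PF⊢ (◇f (□f A) ⇒ □f (◇f A))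
  Kp    : ∀ {A B} → PF⊢ (□p (A ⇒ B) ⇒ (□p A ⇒ □p B))
  Löb   : ∀ {A} → PF⊢ (□p (□p A ⇒ A) ⇒ □p A)
  pf1   : ∀ {A} → PF⊢ (□p A ⇒ □f (□p A))
  pf2   : ∀ {A} → PF⊢ (◇p A ⇒ □f (◇p A))
  pf3   : ∀ {A} → PF⊢ (□p A ⇒ □p (□f A))
  mp    : ∀ {A B} → PF⊢ (A ⇒ B) → PF⊢ A → PF⊢ B
  necp  : ∀ {A} → PF⊢ A → PF⊢ (□p A)
  necf  : ∀ {A} → PF⊢ A → PF⊢ (□f A)

data PFω⊢_ : Fm → Set where
  thm   : ∀ {A} → PF⊢ A → PFω⊢ A
  pfω   : ∀ {A} → PFω⊢ (□p A ⇒ □f A)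
  mp    : ∀ {A B} → PFω⊢ (A ⇒ B) → PFω⊢ A → PFω⊢ B

-- S4.2 ⊆ PF gives one direction. Conversely, fix a PFω-derivation D and
-- interpret □p A as the constant ⊤ or ⊥ according to whether A belongs to
-- the least set of formulas closed under the conditions imposed by the
-- □p-rules used in D: modus ponens and Löb's rule under □p, □f-introduction
-- under □p (axiom pf3), and necessitation of the PF-theorems boxed by □p.
-- This set is the least model of finitely many Horn clauses, hence
-- decidable. Under the collapse every PF-theorem used in D becomes an
-- S4.2-theorem (pf1 and pf2 because constants are □f-stable), and so does
-- □p A → □f A, because every A in the set has an S4.2-provable collapse, by
-- induction along its derivation from the clauses. On L_f the collapse is the identity.
module Submission where

open import Defs
open import Data.Bool using (true; false; not; _∨_)
open import Data.Bool.Properties using (∨-zeroʳ)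
open import Data.List using (List; []; _∷_; _++_; length; map; filter)
open import Data.List.Properties using (filter-notAll)
open import Data.List.Relation.Unary.All as All using (All; []; _∷_; all?)
open import Data.List.Relation.Unary.All.Properties using (map⁺; ++⁺)
open import Data.List.Relation.Unary.Any as Any using (here; there; any?)
open import Data.List.Membership.Propositional using (_∈_; lose)
open import Data.List.Membership.Propositional.Properties
  using (∈-++⁺ˡ; ∈-++⁺ʳ; ∈-++⁻; ∈-map⁺; ∈-filter⁺; ∈-filter⁻)
import Data.List.Membership.DecPropositional as DecMembership
open import Data.List.Relation.Binary.Subset.Propositional using (_⊆_)
open import Data.Nat as ℕ using (_<_)
open import Data.Nat.Induction using (<-wellFounded)
open import Data.Product using (_×_; _,_; Σ; proj₁; proj₂)
open import Data.Sum using (_⊎_; inj₁; inj₂)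
open import Function using (_∘_; id)
open import Induction.WellFounded using (Acc; acc)
open import Relation.Binary.Definitions using (DecidableEquality)
open import Relation.Binary.PropositionalEquality using (_≡_; refl; trans; cong; cong₂; subst)
open import Relation.Nullary using (Dec; yes; no; ¬?; contradiction)
open import Relation.Nullary.Decidable using (map′)
open import Relation.Unary using (Decidable)

module Horn {X C : Set} (premises : C → List X) (conclusion : C → X) where

  Closed : List C → (X → Set) → Set
  Closed cs P = ∀ {c} → c ∈ cs → All P (premises c) → P (conclusion c)

  Closed-⊆ : ∀ {cs ds P} → cs ⊆ ds → Closed ds P → Closed cs P
  Closed-⊆ cs⊆ds closed = closed ∘ cs⊆ds

  data Derivable (cs : List C) : X → Set where
    fire : ∀ {c} → c ∈ cs → All (Derivable cs) (premises c) → Derivable cs (conclusion c)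

  module _ {cs : List C} {P : X → Set} (closed : Closed cs P) where

    derivable-least : ∀ {x} → Derivable cs x → P x
    derivable-leastAll : ∀ {xs} → All (Derivable cs) xs → All P xs

    derivable-least (fire c∈cs ders) = closed c∈cs (derivable-leastAll ders)

    derivable-leastAll []           = []
    derivable-leastAll (der ∷ ders) = derivable-least der ∷ derivable-leastAll ders

  Fires : List X → C → Set
  Fires S c = All (_∈ S) (premises c)

  module _ (_≟_ : DecidableEquality X) (cs : List C) where
    open DecMembership _≟_ using (_∈?_)

    private
      fires? : ∀ S → Decidable (Fires S)
      fires? S c = all? (_∈? S) (premises c)

    -- rest holds the clauses not fired yet; each round fires all of them whose
    -- premises lie in S, so rest shrinks until nothing fires.
    saturate : ∀ rest S → Acc _<_ (length rest) → rest ⊆ cs →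
               (∀ {c} → c ∈ cs → c ∈ rest ⊎ conclusion c ∈ S) → All (Derivable cs) S →
               Σ (List X) λ S′ → Closed cs (_∈ S′) × All (Derivable cs) S′
    saturate rest S (acc smaller) rest⊆cs pending ders with any? (fires? S) rest
    ... | no nothing-fires = S , closed , ders
      where
      closed : Closed cs (_∈ S)
      closed c∈cs fires with pending c∈cs
      ... | inj₁ c∈rest = contradiction (lose c∈rest fires) nothing-fires
      ... | inj₂ done   = done
    ... | yes something-fires =
      saturate unfired (map conclusion fired ++ S)
        (smaller (filter-notAll (¬? ∘ fires? S) rest (Any.map (λ f ¬f → ¬f f) something-fires)))
        (rest⊆cs ∘ proj₁ ∘ ∈-filter⁻ (¬? ∘ fires? S))
        pending′
        (++⁺ (map⁺ (All.tabulate fired-derivable)) ders)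
      where
      fired unfired : List C
      fired   = filter (fires? S) rest
      unfired = filter (¬? ∘ fires? S) rest

      fired-derivable : ∀ {c} → c ∈ fired → Derivable cs (conclusion c)
      fired-derivable c∈fired with ∈-filter⁻ (fires? S) c∈fired
      ... | c∈rest , fires = fire (rest⊆cs c∈rest) (All.map (All.lookup ders) fires)

      pending′ : ∀ {c} → c ∈ cs → c ∈ unfired ⊎ conclusion c ∈ map conclusion fired ++ S
      pending′ {c} c∈cs with pending c∈cs | fires? S c
      ... | inj₂ done   | _            = inj₂ (∈-++⁺ʳ _ done)
      ... | inj₁ c∈rest | yes fires    = inj₂ (∈-++⁺ˡ (∈-map⁺ conclusion (∈-filter⁺ (fires? S) c∈rest fires)))
      ... | inj₁ c∈rest | no ¬fires    = inj₁ (∈-filter⁺ (¬? ∘ fires? S) c∈rest ¬fires)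

    derivable? : Decidable (Derivable cs)
    derivable? x with saturate cs [] (<-wellFounded _) id inj₁ []
    ... | S , closed , ders = map′ (All.lookup ders) (derivable-least closed) (x ∈? S)

infix 4 _≟ᶠ_
_≟ᶠ_ : DecidableEquality Fm
var m ≟ᶠ var n with m ℕ.≟ n
... | yes refl = yes refl
... | no m≢n   = no λ { refl → m≢n refl }
⊥' ≟ᶠ ⊥' = yes refl
(A ⇒ B) ≟ᶠ (C ⇒ D) with A ≟ᶠ C | B ≟ᶠ D
... | yes refl | yes refl = yes refl
... | no A≢C   | _        = no λ { refl → A≢C refl }
... | yes _    | no B≢D   = no λ { refl → B≢D refl }
□f A ≟ᶠ □f B with A ≟ᶠ B
... | yes refl = yes refl
... | no A≢B   = no λ { refl → A≢B refl }
□p A ≟ᶠ □p B with A ≟ᶠ B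
... | yes refl = yes refl
... | no A≢B   = no λ { refl → A≢B refl }
var _   ≟ᶠ ⊥'      = no λ ()
var _   ≟ᶠ (_ ⇒ _) = no λ ()
var _   ≟ᶠ □f _    = no λ ()
var _   ≟ᶠ □p _    = no λ ()
⊥'      ≟ᶠ var _   = no λ ()
⊥'      ≟ᶠ (_ ⇒ _) = no λ ()
⊥'      ≟ᶠ □f _    = no λ ()
⊥'      ≟ᶠ □p _    = no λ ()
(_ ⇒ _) ≟ᶠ var _   = no λ ()
(_ ⇒ _) ≟ᶠ ⊥'      = no λ ()
(_ ⇒ _) ≟ᶠ □f _    = no λ ()
(_ ⇒ _) ≟ᶠ □p _    = no λ ()
□f _    ≟ᶠ var _   = no λ ()
□f _    ≟ᶠ ⊥'      = no λ ()
□f _    ≟ᶠ (_ ⇒ _) = no λ ()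
□f _    ≟ᶠ □p _    = no λ ()
□p _    ≟ᶠ var _   = no λ ()
□p _    ≟ᶠ ⊥'      = no λ ()
□p _    ≟ᶠ (_ ⇒ _) = no λ ()
□p _    ≟ᶠ □f _    = no λ ()

⊤' : Fm
⊤' = ¬' ⊥'

⊤'-Lf : IsLf ⊤'
⊤'-Lf = ⊥' ⇒ ⊥'

S42⊢⊤ : S42⊢ ⊤'
S42⊢⊤ = taut ⊤'-Lf λ _ → refl

ex-falso : ∀ {A} → IsLf A → S42⊢ (⊥' ⇒ A)
ex-falso lfA = taut (⊥' ⇒ lfA) λ _ → refl

weaken : ∀ {A B} → IsLf A → IsLf B → S42⊢ A → S42⊢ (B ⇒ A)
weaken {A} {B} lfA lfB ⊢A = mp (taut (lfA ⇒ (lfB ⇒ lfA)) A⇒B⇒A) ⊢A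
  where
  A⇒B⇒A : Tautology (A ⇒ (B ⇒ A))
  A⇒B⇒A v with eval v A
  ... | true  = ∨-zeroʳ (not (eval v B))
  ... | false = refl

private
  variable
    P Q : Set

⌜_⌝ : Dec P → Fm
⌜ yes _ ⌝ = ⊤'
⌜ no _ ⌝  = ⊥'

⌜⌝-Lf : (P? : Dec P) → IsLf ⌜ P? ⌝
⌜⌝-Lf (yes _) = ⊤'-Lf
⌜⌝-Lf (no _)  = ⊥'

eval-⌜⌝ : ∀ v (P? : Dec P) → eval v ⌜ P? ⌝ ≡ Dec.does P?
eval-⌜⌝ v (yes _) = refl
eval-⌜⌝ v (no _)  = refl

⌜⌝-provable : (P? : Dec P) → P → S42⊢ ⌜ P? ⌝
⌜⌝-provable (yes _) _ = S42⊢⊤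
⌜⌝-provable (no ¬p) p = contradiction p ¬p

⌜⌝-⇒ : ∀ {A} → IsLf A → (P? : Dec P) → (P → S42⊢ A) → S42⊢ (⌜ P? ⌝ ⇒ A)
⌜⌝-⇒ lfA (yes p) ⊢A = weaken lfA ⊤'-Lf (⊢A p)
⌜⌝-⇒ lfA (no _)  _  = ex-falso lfA

⌜⌝-mono : (P? : Dec P) (Q? : Dec Q) → (P → Q) → S42⊢ (⌜ P? ⌝ ⇒ ⌜ Q? ⌝)
⌜⌝-mono P? Q? P⇒Q = ⌜⌝-⇒ (⌜⌝-Lf Q?) P? (⌜⌝-provable Q? ∘ P⇒Q)

⌜⌝-□f-stable : (P? : Dec P) → S42⊢ (⌜ P? ⌝ ⇒ □f ⌜ P? ⌝)
⌜⌝-□f-stable P? = ⌜⌝-⇒ (□f (⌜⌝-Lf P?)) P? (nec ∘ ⌜⌝-provable P?)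

¬⌜⌝-□f-stable : (P? : Dec P) → S42⊢ (¬' ⌜ P? ⌝ ⇒ □f (¬' ⌜ P? ⌝))
¬⌜⌝-□f-stable (yes _) = taut ((⊤'-Lf ⇒ ⊥') ⇒ □f (⊤'-Lf ⇒ ⊥')) λ _ → refl
¬⌜⌝-□f-stable (no _)  = weaken (□f ⊤'-Lf) ⊤'-Lf (nec S42⊢⊤)

data Condition : Set where
  mp-closed    : Fm → Fm → Condition
  löb-closed   : Fm → Condition
  □f-closed    : Fm → Condition
  necessitated : ∀ {A} → PF⊢ A → Condition

premises : Condition → List Fm
premises (mp-closed A B)  = (A ⇒ B) ∷ A ∷ []
premises (löb-closed A)   = (□p A ⇒ A) ∷ []
premises (□f-closed A)    = A ∷ []
premises (necessitated _) = []

conclusion : Condition → Fm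
conclusion (mp-closed A B)          = B
conclusion (löb-closed A)           = A
conclusion (□f-closed A)            = □f A
conclusion (necessitated {A = A} _) = A

open Horn premises conclusion

conditions : ∀ {A} → PF⊢ A → List Condition
conditions (Kp {A} {B}) = mp-closed A B ∷ []
conditions (Löb {A})    = löb-closed A ∷ []
conditions (pf3 {A})    = □f-closed A ∷ []
conditions (mp d e)     = conditions d ++ conditions e
conditions (necp d)     = necessitated d ∷ conditions d
conditions (necf d)     = conditions d
conditions _            = []

conditionsω : ∀ {A} → PFω⊢ A → List Condition
conditionsω (thm d)  = conditions d
conditionsω pfω      = []
conditionsω (mp d e) = conditionsω d ++ conditionsω e

conditions-necessitated : ∀ {A B} {e : PF⊢ A} (d : PF⊢ B) →
                          necessitated e ∈ conditions d → conditions e ⊆ conditions d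
conditions-necessitated Kp (here ())
conditions-necessitated Löb (here ())
conditions-necessitated pf3 (here ())
conditions-necessitated (mp d e) e∈ with ∈-++⁻ (conditions d) e∈
... | inj₁ e∈d = ∈-++⁺ˡ ∘ conditions-necessitated d e∈d
... | inj₂ e∈e = ∈-++⁺ʳ (conditions d) ∘ conditions-necessitated e e∈e
conditions-necessitated (necp d) (here refl) = there
conditions-necessitated (necp d) (there e∈)  = there ∘ conditions-necessitated d e∈
conditions-necessitated (necf d) e∈          = conditions-necessitated d e∈

conditionsω-necessitated : ∀ {A B} {e : PF⊢ A} (D : PFω⊢ B) →
                           necessitated e ∈ conditionsω D → conditions e ⊆ conditionsω D
conditionsω-necessitated (thm d) e∈ = conditions-necessitated d e∈
conditionsω-necessitated (mp D E) e∈ with ∈-++⁻ (conditionsω D) e∈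
... | inj₁ e∈D = ∈-++⁺ˡ ∘ conditionsω-necessitated D e∈D
... | inj₂ e∈E = ∈-++⁺ʳ (conditionsω D) ∘ conditionsω-necessitated E e∈E

module Collapse {P : Fm → Set} (P? : Decidable P) where

  collapse : Fm → Fm
  collapse (var n) = var n
  collapse ⊥'      = ⊥'
  collapse (A ⇒ B) = collapse A ⇒ collapse B
  collapse (□f A)  = □f (collapse A)
  collapse (□p A)  = ⌜ P? A ⌝

  collapse-Lf : ∀ A → IsLf (collapse A)
  collapse-Lf (var n) = var n
  collapse-Lf ⊥'      = ⊥'
  collapse-Lf (A ⇒ B) = collapse-Lf A ⇒ collapse-Lf B
  collapse-Lf (□f A)  = □f (collapse-Lf A)
  collapse-Lf (□p A)  = ⌜⌝-Lf (P? A)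

  collapse-id : ∀ {A} → IsLf A → collapse A ≡ A
  collapse-id (var n)   = refl
  collapse-id ⊥'        = refl
  collapse-id (lA ⇒ lB) = cong₂ _⇒_ (collapse-id lA) (collapse-id lB)
  collapse-id (□f lA)   = cong □f (collapse-id lA)

  collapse-valuation : Valuation → Valuation
  collapse-valuation v = record
    { atom = Valuation.atom v
    ; boxf = Valuation.boxf v ∘ collapse
    ; boxp = Dec.does ∘ P?
    }

  eval-collapse : ∀ v A → eval v (collapse A) ≡ eval (collapse-valuation v) A
  eval-collapse v (var n) = refl
  eval-collapse v ⊥'      = refl
  eval-collapse v (A ⇒ B) = cong₂ (λ a b → not a ∨ b) (eval-collapse v A) (eval-collapse v B)
  eval-collapse v (□f A)  = refl
  eval-collapse v (□p A)  = eval-⌜⌝ v (P? A)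

  collapse-taut : ∀ A → Tautology A → Tautology (collapse A)
  collapse-taut A taut-A v = trans (eval-collapse v A) (taut-A (collapse-valuation v))

  collapse-sound : ∀ {A} (d : PF⊢ A) → Closed (conditions d) P → S42⊢ collapse A
  collapse-sound (taut {A} t) _ = taut (collapse-Lf A) (collapse-taut A t)
  collapse-sound (Kf {A} {B}) _ = K (collapse-Lf A) (collapse-Lf B)
  collapse-sound (Tf {A})     _ = T (collapse-Lf A)
  collapse-sound (4f {A})     _ = ax4 (collapse-Lf A)
  collapse-sound (2f {A})     _ = ax2 (collapse-Lf A)
  collapse-sound (Kp {A} {B}) closed =
    ⌜⌝-⇒ (⌜⌝-Lf (P? A) ⇒ ⌜⌝-Lf (P? B)) (P? (A ⇒ B)) λ pA⇒B →
      ⌜⌝-mono (P? A) (P? B) λ pA → closed (here refl) (pA⇒B ∷ pA ∷ [])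
  collapse-sound (Löb {A})    closed = ⌜⌝-mono (P? (□p A ⇒ A)) (P? A) λ p → closed (here refl) (p ∷ [])
  collapse-sound (pf1 {A})    _ = ⌜⌝-□f-stable (P? A)
  collapse-sound (pf2 {A})    _ = ¬⌜⌝-□f-stable (P? (¬' A))
  collapse-sound (pf3 {A})    closed = ⌜⌝-mono (P? A) (P? (□f A)) λ p → closed (here refl) (p ∷ [])
  collapse-sound (mp d e)     closed =
    mp (collapse-sound d (Closed-⊆ ∈-++⁺ˡ closed)) (collapse-sound e (Closed-⊆ (∈-++⁺ʳ _) closed))
  collapse-sound (necp {A} d) closed = ⌜⌝-provable (P? A) (closed (here refl) [])
  collapse-sound (necf d)     closed = nec (collapse-sound d closed)

module _ {B} (D : PFω⊢ B) where
  derivableᴰ? : Decidable (Derivable (conditionsω D))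
  derivableᴰ? = derivable? _≟ᶠ_ (conditionsω D)

  open Collapse derivableᴰ?

  conclusion-sound : ∀ {c} → c ∈ conditionsω D → Derivable (conditionsω D) (conclusion c) →
                     All (S42⊢_ ∘ collapse) (premises c) → S42⊢ collapse (conclusion c)
  conclusion-sound {mp-closed _ _} _ _ (⊢A⇒B ∷ ⊢A ∷ []) = mp ⊢A⇒B ⊢A
  conclusion-sound {löb-closed A} _ der (⊢□pA⇒A ∷ []) = mp ⊢□pA⇒A (⌜⌝-provable (derivableᴰ? A) der)
  conclusion-sound {□f-closed _} _ _ (⊢A ∷ []) = nec ⊢A
  conclusion-sound {necessitated e} e∈ _ [] =
    collapse-sound e (Closed-⊆ (conditionsω-necessitated D e∈) fire)

  derivable-sound : ∀ {A} → Derivable (conditionsω D) A → S42⊢ collapse A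
  derivable-sound = proj₂ ∘ derivable-least derivable-and-sound
    where
    derivable-and-sound : Closed (conditionsω D) λ A → Derivable (conditionsω D) A × S42⊢ collapse A
    derivable-and-sound c∈ hyps =
      let der = fire c∈ (All.map proj₁ hyps)
      in der , conclusion-sound c∈ der (All.map proj₂ hyps)

  collapse-soundω : ∀ {A} (d : PFω⊢ A) → conditionsω d ⊆ conditionsω D → S42⊢ collapse A
  collapse-soundω (thm d)  d⊆D = collapse-sound d (Closed-⊆ d⊆D fire)
  collapse-soundω (pfω {A}) _  =
    ⌜⌝-⇒ (□f (collapse-Lf A)) (derivableᴰ? A) (nec ∘ derivable-sound)
  collapse-soundω (mp d e) d⊆D =
    mp (collapse-soundω d (d⊆D ∘ ∈-++⁺ˡ)) (collapse-soundω e (d⊆D ∘ ∈-++⁺ʳ (conditionsω d)))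

  PFω⊢⇒S42⊢ : IsLf B → S42⊢ B
  PFω⊢⇒S42⊢ lfB = subst S42⊢_ (collapse-id lfB) (collapse-soundω D id)

S42⊢⇒PF⊢ : ∀ {A} → S42⊢ A → PF⊢ A
S42⊢⇒PF⊢ (taut _ t) = taut t
S42⊢⇒PF⊢ (K _ _)    = Kf
S42⊢⇒PF⊢ (T _)      = Tf
S42⊢⇒PF⊢ (ax4 _)    = 4f
S42⊢⇒PF⊢ (ax2 _)    = 2f
S42⊢⇒PF⊢ (mp d e)   = mp (S42⊢⇒PF⊢ d) (S42⊢⇒PF⊢ e)
S42⊢⇒PF⊢ (nec d)    = necf (S42⊢⇒PF⊢ d)

propositionA5 : ∀ (A : Fm) → IsLf A → ((PFω⊢ A → S42⊢ A) × (S42⊢ A → PFω⊢ A))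
propositionA5 A lfA = (λ D → PFω⊢⇒S42⊢ D lfA) , thm ∘ S42⊢⇒PF⊢
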